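{- If $\mathcal H$ is an FT-tight simple program and $X$ is a non-empty set of atoms, then there exists a non-empty subset $K\subseteq X$ such that, in the subgraph of the dependency graph of $\mathcal H$ induced by $X$, (i) there are no edges from atoms in $K$ to atoms in $X\setminus K$, and (ii) no atom in $K$ has outgoing FT-critical edges.
   Context: Extended literals over a set of atoms: $p,\neg p,\neg\neg p$ (with $\neg F=F\to\bot$). A simple disjunction is a (possibly infinite) disjunction of extended literals; a simple implication is $\mathcal A^\land\to\mathcal L^\lor$ with $\mathcal A$ a set of atoms and $\mathcal L^\lor$ a simple disjunction; it is positive if $\mathcal L$ is a set of atoms and non-positive otherwise. A simple formula is a conjunction of simple implications; a simple rule is $G\to H$ with $G$ a simple formula and $H$ a disjunction of atoms; a simple program is a set of simple rules. An atom $q$ occurs strictly positively in a simple formula $G$ if $q\in\mathcal L$ for some conjunctive term $\mathcal A^\land\to\mathcal L^\lor$ of $G$, and occurs positively if $q$ or $\neg\neg q$ belongs to such an $\mathcal L$. The dependency graph of $\mathcal H$ has the atoms occurring in $\mathcal H$ as vertices and an edge $p\to q$ if for some $G\to H\in\mathcal H$, $p$ is a disjunctive term of $H$ and $q$ occurs positively in $G$; the edge is FT-critical if for some $G\to H\in\mathcal H$, $p$ is a disjunctive term of $H$ and $q$ occurs strictly positively in some non-positive conjunctive term of $G$. $\mathcal H$ is FT-tight if its dependency graph has no path containing infinitely many FT-critical edges. -}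

module Defs where

open import Level using (0ℓ)
open import Data.Nat using (ℕ; suc; _≥_)
open import Data.Product using (Σ; ∃; _×_; Σ-syntax; ∃-syntax)
open import Data.Sum using (_⊎_)
open import Relation.Nullary using (¬_)
open import Relation.Unary using (Pred; _∈_; _⊆_)

data ExtLit (Atom : Set) : Set where
  atom   : Atom → ExtLit Atom
  neg    : Atom → ExtLit Atom
  negneg : Atom → ExtLit Atom

-- Simple implication  A^∧ → L^∨  with A a (possibly infinite) set of atoms
-- and L a (possibly infinite) set of extended literals.
record SimpleImpl (Atom : Set) : Set₁ where
  field
    ante : Pred Atom 0ℓ
    cons : Pred (ExtLit Atom) 0ℓ
open SimpleImpl public

IsAtomLit : {Atom : Set} → ExtLit Atom → Set
IsAtomLit (atom _)   = Data.Unit.⊤ where import Data.Unit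
IsAtomLit (neg _)    = Data.Empty.⊥ where import Data.Empty
IsAtomLit (negneg _) = Data.Empty.⊥ where import Data.Empty

Positive : {Atom : Set} → SimpleImpl Atom → Set
Positive i = ∀ l → l ∈ cons i → IsAtomLit l

NonPositive : {Atom : Set} → SimpleImpl Atom → Set
NonPositive i = ¬ Positive i

-- A simple formula: a (possibly infinite) conjunction of simple implications,
-- represented by the set of its conjunctive terms.
SimpleFormula : Set → Set₁
SimpleFormula Atom = Pred (SimpleImpl Atom) 0ℓ

-- A simple rule G → H, H a (possibly infinite) disjunction of atoms,
-- represented by the set of its disjunctive terms.
record SimpleRule (Atom : Set) : Set₁ where
  field
    body : SimpleFormula Atom
    head : Pred Atom 0ℓ
open SimpleRule public

SimpleProgram : Set → Set₁
SimpleProgram Atom = Pred (SimpleRule Atom) 0ℓ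

module _ {Atom : Set} where

  StrictPosIn : Atom → SimpleImpl Atom → Set
  StrictPosIn q i = atom q ∈ cons i

  OccursPositively : Atom → SimpleFormula Atom → Set₁
  OccursPositively q G =
    Σ[ i ∈ SimpleImpl Atom ] (i ∈ G × (atom q ∈ cons i ⊎ negneg q ∈ cons i))

  OccursStrictPosNonPos : Atom → SimpleFormula Atom → Set₁
  OccursStrictPosNonPos q G =
    Σ[ i ∈ SimpleImpl Atom ] (i ∈ G × NonPositive i × StrictPosIn q i)

  Edge : SimpleProgram Atom → Atom → Atom → Set₁
  Edge H p q =
    Σ[ r ∈ SimpleRule Atom ] (r ∈ H × p ∈ head r × OccursPositively q (body r))

  FTCritical : SimpleProgram Atom → Atom → Atom → Set₁
  FTCritical H p q =
    Σ[ r ∈ SimpleRule Atom ] (r ∈ H × p ∈ head r × OccursStrictPosNonPos q (body r))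

  InfinitelyCriticalPath : SimpleProgram Atom → (ℕ → Atom) → Set₁
  InfinitelyCriticalPath H f =
    (∀ n → Edge H (f n) (f (suc n))) ×
    (∀ n → ∃[ m ] (m ≥ n × FTCritical H (f m) (f (suc m))))

  FTTight : SimpleProgram Atom → Set₁
  FTTight H = ¬ (Σ[ f ∈ (ℕ → Atom) ] InfinitelyCriticalPath H f)

module Submission where

open import Defs
open import Level using (Level; 0ℓ; suc; _⊔_)
open import Data.Nat using (ℕ; _+_; _≥_) renaming (suc to 1+)
open import Data.Nat.GeneralisedArithmetic using (fold; fold-+)
open import Data.Nat.Properties using (m≤n+m)
open import Data.Product using (Σ; _×_; Σ-syntax; ∃-syntax; _,_; proj₁)
open import Data.Sum using (inj₁)
open import Relation.Binary using (Rel; _⇒_)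
open import Relation.Binary.Construct.Closure.ReflexiveTransitive using (Star; ε; _◅_; _◅◅_)
open import Relation.Binary.PropositionalEquality using (subst; sym)
open import Relation.Nullary using (¬_; yes; no; contradiction)
open import Relation.Nullary.Decidable using (True; toWitness; fromWitness)
open import Relation.Unary using (Pred; _∈_; _⊆_)
open import Axiom.ExcludedMiddle using (ExcludedMiddle)
open import Axiom.DoubleNegationElimination using (em⇒dne)

-- Every vertex of X either reaches, inside X, a critical edge into X, or it does
-- not; in the second case its reachability set inside X is the required K, and if
-- the first case holds everywhere in X, chaining these finite detours yields an
-- infinite path through infinitely many critical edges.

module _ {a ℓ ℓ′ : Level} {A : Set a} (E C : Rel A ℓ) (C⊆E : C ⇒ E) (X : Pred A ℓ′) where

  InfinitelyOftenCritical : (ℕ → A) → Set ℓ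
  InfinitelyOftenCritical f =
    (∀ n → E (f n) (f (1+ n))) × (∀ n → ∃[ m ] (m ≥ n × C (f m) (f (1+ m))))

  EdgeInto : Rel A (ℓ ⊔ ℓ′)
  EdgeInto x y = E x y × y ∈ X

  star-into-closed : ∀ {x y} → x ∈ X → Star EdgeInto x y → y ∈ X
  star-into-closed x∈X ε               = x∈X
  star-into-closed _   ((_ , y∈X) ◅ r) = star-into-closed y∈X r

  LeadsToCritical : A → Set (a ⊔ ℓ ⊔ ℓ′)
  LeadsToCritical x = Σ[ y ∈ A ] Σ[ z ∈ A ] (Star EdgeInto x y × z ∈ X × C y z)

  module CriticalWalk (leads : ∀ x → x ∈ X → LeadsToCritical x) where

    -- A walker carries a pending detour; once it has crossed the critical edge at
    -- the end, it draws a fresh detour from the vertex it has reached.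
    Walker : Set (a ⊔ ℓ ⊔ ℓ′)
    Walker = Σ A LeadsToCritical

    position : Walker → A
    position = proj₁

    step : Walker → Walker
    step (_ , _ , z , ε     , z∈X , _) = z , leads z z∈X
    step (_ , y , z , _ ◅ r , z∈X , c) = _ , y , z , r , z∈X , c

    step-edge : ∀ w → E (position w) (position (step w))
    step-edge (_ , _ , _ , ε           , _ , c) = C⊆E c
    step-edge (_ , _ , _ , (e , _) ◅ _ , _ , _) = e

    walk : Walker → ℕ → Walker
    walk w n = fold w step n

    CriticalAt : Walker → Set ℓ
    CriticalAt w = C (position w) (position (step w))

    critical-ahead : ∀ w → ∃[ k ] CriticalAt (walk w k)
    critical-ahead (x , y , z , r , z∈X , c) = along r
      where
      along : ∀ {x} (r : Star EdgeInto x y) → ∃[ k ] CriticalAt (walk (x , y , z , r , z∈X , c) k)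
      along ε       = 0 , c
      along (e ◅ r) with along r
      ... | k , crit = k + 1 , subst CriticalAt (sym (fold-+ (_ , y , z , e ◅ r , z∈X , c) step k {1})) crit

    infinitely-critical : ∀ w → InfinitelyOftenCritical (λ n → position (walk w n))
    infinitely-critical w = (λ n → step-edge (walk w n)) , later
      where
      later : ∀ n → ∃[ m ] (m ≥ n × C (position (walk w m)) (position (walk w (1+ m))))
      later n with critical-ahead (walk w n)
      ... | k , crit = k + n , m≤n+m n k , subst CriticalAt (sym (fold-+ w step k {n})) crit

  module _ (em : ExcludedMiddle (a ⊔ ℓ ⊔ ℓ′)) where

    reachable-closed-critical-free : ∀ {x} → x ∈ X → ¬ LeadsToCritical x →
      Σ[ K ∈ Pred A 0ℓ ]
        (K ⊆ X × (∃[ k ] k ∈ K)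
         × (∀ p q → p ∈ K → q ∈ X → E p q → q ∈ K)
         × (∀ p q → p ∈ K → q ∈ X → ¬ C p q))
    reachable-closed-critical-free {x} x∈X ¬leads =
      K , (λ k → star-into-closed x∈X (toWitness k)) , (x , fromWitness ε)
        , (λ _ _ k q∈X e → fromWitness (toWitness k ◅◅ (e , q∈X) ◅ ε))
        , (λ _ _ k q∈X c → ¬leads (_ , _ , toWitness k , q∈X , c))
      where
      -- Reachability lives in a higher universe; excluded middle squashes it to a Set.
      K : Pred A 0ℓ
      K y = True (em {Star EdgeInto x y})

    closed-critical-free-subset : ¬ (Σ[ f ∈ (ℕ → A) ] InfinitelyOftenCritical f) → ∃[ x ] x ∈ X →
      Σ[ K ∈ Pred A 0ℓ ]
        (K ⊆ X × (∃[ k ] k ∈ K)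
         × (∀ p q → p ∈ K → q ∈ X → E p q → q ∈ K)
         × (∀ p q → p ∈ K → q ∈ X → ¬ C p q))
    closed-critical-free-subset noPath (x₀ , x₀∈X) with em {Σ[ x ∈ A ] (x ∈ X × ¬ LeadsToCritical x)}
    ... | yes (x , x∈X , ¬leads) = reachable-closed-critical-free x∈X ¬leads
    ... | no  ¬free = contradiction (_ , infinitely-critical (x₀ , leads x₀ x₀∈X)) noPath
      where
      leads : ∀ x → x ∈ X → LeadsToCritical x
      leads x x∈X = em⇒dne em λ ¬leads → ¬free (x , x∈X , ¬leads)
      open CriticalWalk leads

FTCritical⇒Edge : ∀ {Atom : Set} {H : SimpleProgram Atom} → FTCritical H ⇒ Edge H
FTCritical⇒Edge (r , r∈H , p∈head , i , i∈body , _ , q∈cons) = r , r∈H , p∈head , i , i∈body , inj₁ q∈cons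

lemma3 : ExcludedMiddle (suc 0ℓ) →
    {Atom : Set} (H : SimpleProgram Atom) → FTTight H →
    (X : Pred Atom 0ℓ) → (∃[ x ] x ∈ X) →
    Σ[ K ∈ Pred Atom 0ℓ ]
      (K ⊆ X × (∃[ k ] k ∈ K)
       × (∀ p q → p ∈ K → q ∈ X → Edge H p q → q ∈ K)
       × (∀ p q → p ∈ K → q ∈ X → ¬ FTCritical H p q))
lemma3 em H tight X = closed-critical-free-subset (Edge H) (FTCritical H) FTCritical⇒Edge X em tight
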